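{- Let $\Psi=(\Sigma,\mathit{ind})$ be a concurrent alphabet with a total order $\le$ on $\Sigma$, and let $\sigma$ be a (sequential) trace over $\Psi$, i.e. an equivalence class of $\equiv^\Sigma_\Psi$. Then there exists a unique step trace $\tau$ over $\Psi$ such that $lex(\tau)=\sigma$.
   Context: A concurrent alphabet is $\Psi=(\Sigma,\mathit{ind})$ with $\Sigma$ finite nonempty and $\mathit{ind}$ irreflexive and symmetric. $\equiv^\Sigma_\Psi$ on $\Sigma^*$ is the reflexive transitive closure of $uabz\sim ubaz$ for $(a,b)\in\mathit{ind}$. Steps over $\Psi$: nonempty subsets of $\Sigma$ whose distinct elements are pairwise in $\mathit{ind}$. Step traces are the equivalence classes of the reflexive, symmetric, transitive closure of $uABz\sim u(A\cup B)z$ on step sequences, for steps $A,B$ with $A\times B\subseteq\mathit{ind}$. For a step $A$, $lex(A)$ lists the elements of $A$ in increasing $\le$-order; $lex(A_1\ldots A_n)=lex(A_1)\cdots lex(A_n)$; for a set $X$ of step sequences, $lex(X)=\{lex(w)\mid w\in X\}$. -}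

module Defs where

open import Level using (0ℓ)
open import Data.Nat using (ℕ)
open import Data.Fin using (Fin)
open import Data.Fin.Subset using (Subset; _∈_; _∪_; Nonempty)
open import Data.Fin.Subset.Properties using (_∈?_)
open import Data.List using (List; []; _∷_; _++_; filter; concatMap; allFin)
open import Data.Product using (_×_; ∃; _,_)
open import Relation.Binary using (Rel; IsDecTotalOrder; DecTotalOrder)
open import Relation.Binary.PropositionalEquality using (_≡_; _≢_)
open import Relation.Binary.Construct.Closure.Equivalence using (EqClosure)
import Data.List.Sort

data SeqStep {n : ℕ} (ind : Rel (Fin n) 0ℓ) : Rel (List (Fin n)) 0ℓ where
  swap : ∀ (u z : List (Fin n)) (a b : Fin n) → ind a b →
         SeqStep ind (u ++ a ∷ b ∷ z) (u ++ b ∷ a ∷ z)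

TraceEq : {n : ℕ} → Rel (Fin n) 0ℓ → Rel (List (Fin n)) 0ℓ
TraceEq ind = EqClosure (SeqStep ind)

IsStep : {n : ℕ} → Rel (Fin n) 0ℓ → Subset n → Set
IsStep ind A = Nonempty A × (∀ a b → a ∈ A → b ∈ A → a ≢ b → ind a b)

data IsStepSeq {n : ℕ} (ind : Rel (Fin n) 0ℓ) : List (Subset n) → Set where
  []  : IsStepSeq ind []
  _∷_ : ∀ {A t} → IsStep ind A → IsStepSeq ind t → IsStepSeq ind (A ∷ t)

Indep : {n : ℕ} → Rel (Fin n) 0ℓ → Subset n → Subset n → Set
Indep ind A B = ∀ a b → a ∈ A → b ∈ B → ind a b

data StepStep {n : ℕ} (ind : Rel (Fin n) 0ℓ) : Rel (List (Subset n)) 0ℓ where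
  merge : ∀ (u z : List (Subset n)) (A B : Subset n) →
          IsStep ind A → IsStep ind B → Indep ind A B →
          StepStep ind (u ++ A ∷ B ∷ z) (u ++ (A ∪ B) ∷ z)

StepTraceEq : {n : ℕ} → Rel (Fin n) 0ℓ → Rel (List (Subset n)) 0ℓ
StepTraceEq ind = EqClosure (StepStep ind)

lexStep : {n : ℕ} (_≼_ : Rel (Fin n) 0ℓ) → IsDecTotalOrder _≡_ _≼_ →
          Subset n → List (Fin n)
lexStep {n} _≼_ isDTO A = sort (filter (_∈? A) (allFin n))
  where
    O : DecTotalOrder 0ℓ 0ℓ 0ℓ
    O = record { Carrier = Fin n ; _≈_ = _≡_ ; _≤_ = _≼_ ; isDecTotalOrder = isDTO }
    open Data.List.Sort O using (sort)

lexSeq : {n : ℕ} (_≼_ : Rel (Fin n) 0ℓ) → IsDecTotalOrder _≡_ _≼_ →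
         List (Subset n) → List (Fin n)
lexSeq _≼_ isDTO = concatMap (lexStep _≼_ isDTO)

-- lex(τ) = σ, where τ = [t] (step trace) and σ = [w] (trace):
-- { lex(t') | t' ∈ [t] } = [w]
LexOfClassIs : {n : ℕ} (ind : Rel (Fin n) 0ℓ) (_≼_ : Rel (Fin n) 0ℓ) →
               IsDecTotalOrder _≡_ _≼_ → List (Subset n) → List (Fin n) → Set
LexOfClassIs ind _≼_ isDTO t w =
  ∀ v → (TraceEq ind w v → ∃ λ t' → StepTraceEq ind t t' × lexSeq _≼_ isDTO t' ≡ v)
      × ((∃ λ t' → StepTraceEq ind t t' × lexSeq _≼_ isDTO t' ≡ v) → TraceEq ind w v)

module Submission where

-- The witness is the step sequence of singletons ⁅a₁⁆ … ⁅aₖ⁆ of w = a₁ … aₖ.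
-- The proof rests on three facts relating words and step sequences:
--   * soundness: step-trace equivalent sequences have trace-equivalent lex
--     images.  A merge u A B z ∼ u (A ∪ B) z only permutes the letters of the
--     step A ∪ B, and any two duplicate-free enumerations of a step are
--     trace equivalent (the letters pairwise commute, see 'enumerations-∼');
--   * completeness: trace-equivalent words have step-trace equivalent
--     singleton sequences, since a swap a b ↦ b a is a merge into ⁅a⁆ ∪ ⁅b⁆
--     followed by a split;
--   * normal form: every step sequence t is step-trace equivalent to the
--     singleton sequence of lex(t), obtained by splitting each step.
-- Since lex of a singleton sequence is the word itself, soundness and
-- completeness give lex(τ) = [w]; for uniqueness, any t' with lex(t') = [w]
-- satisfies w ≡ lex(t'), hence τ ≡ singletons(lex t') ≡ t'.

open import Defs
open import Level using (0ℓ)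
open import Data.Nat using (ℕ; _<_)
open import Data.Fin using (Fin)
open import Data.Fin.Subset using (Subset; ⁅_⁆; _∪_) renaming (_∈_ to _∈ₛ_)
open import Data.Fin.Subset.Properties using (x∈⁅x⁆; x∈⁅y⁆⇒x≡y; x∈p∪q⁻; x∈p∪q⁺; ⊆-antisym; ∪-comm; _∈?_)
open import Data.List using (List; []; _∷_; _++_; [_]; map; allFin)
open import Data.List.Properties using (map-++; concatMap-++; ++-assoc)
open import Data.List.Membership.Propositional using (_∈_)
open import Data.List.Membership.Propositional.Properties using (∈-filter⁺; ∈-filter⁻; ∈-allFin; ∈-∃++; ∈-++⁻; ∈-++⁺ˡ; ∈-++⁺ʳ)
open import Data.List.Relation.Unary.Any using (here; there)
open import Data.List.Relation.Unary.All using (All; []; _∷_; lookup; tabulate)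
open import Data.List.Relation.Unary.AllPairs using (_∷_)
open import Data.List.Relation.Unary.Unique.Propositional using (Unique)
import Data.List.Relation.Unary.Unique.Propositional.Properties as Unique
open import Data.List.Relation.Binary.Permutation.Propositional using (_↭_; ↭-sym; ↭⇒↭ₛ)
open import Data.List.Relation.Binary.Permutation.Propositional.Properties using (∈-resp-↭; shift)
import Data.List.Relation.Binary.Permutation.Setoid.Properties as PermutationSetoid
open import Data.Product using (_×_; ∃; _,_; proj₁; proj₂)
open import Data.Sum using (inj₁; inj₂)
open import Data.Empty using (⊥-elim)
open import Relation.Nullary using (¬_)
open import Relation.Binary using (Rel; IsDecTotalOrder; DecTotalOrder; Irreflexive; Symmetric)
open import Relation.Binary.PropositionalEquality using (_≡_; _≢_; refl; sym; trans; cong; cong₂; subst; subst₂; setoid; module ≡-Reasoning)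
open import Relation.Binary.Construct.Closure.Equivalence using (gmap; gfold; isEquivalence; symmetric)
open import Relation.Binary.Construct.Closure.Symmetric using (SymClosure; fwd; bwd)
open import Relation.Binary.Construct.Closure.ReflexiveTransitive using (ε; _◅_; _◅◅_)
import Data.List.Sort

unique-↭ : ∀ {A : Set} {xs ys : List A} → xs ↭ ys → Unique xs → Unique ys
unique-↭ p = PermutationSetoid.Unique-resp-↭ (setoid _) (↭⇒↭ₛ p)

unique-singleton : ∀ {A : Set} {a : A} (l : List A) → Unique l →
                   (∀ {x} → x ∈ l → x ≡ a) → a ∈ l → l ≡ [ a ]
unique-singleton (x ∷ []) _ only _ = cong [_] (only (here refl))
unique-singleton (x ∷ y ∷ l) ((x≢y ∷ _) ∷ _) only _ =
  ⊥-elim (x≢y (trans (only (here refl)) (sym (only (there (here refl))))))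

unique-remove : ∀ {A : Set} {y : A} (p q : List A) → Unique (p ++ y ∷ q) →
                All (y ≢_) (p ++ q) × Unique (p ++ q)
unique-remove p q u with unique-↭ (shift _ p q) u
... | y∉ ∷ u' = y∉ , u'

∈-insert : ∀ {A : Set} {x y : A} (p q : List A) → x ∈ p ++ q → x ∈ p ++ y ∷ q
∈-insert p q x∈ with ∈-++⁻ p x∈
... | inj₁ x∈p = ∈-++⁺ˡ x∈p
... | inj₂ x∈q = ∈-++⁺ʳ p (there x∈q)

∈-remove : ∀ {A : Set} {x y : A} (p q : List A) → x ∈ p ++ y ∷ q → x ≢ y → x ∈ p ++ q
∈-remove p q x∈ x≢y with ∈-++⁻ p x∈
... | inj₁ x∈p = ∈-++⁺ˡ x∈p
... | inj₂ (here x≡y) = ⊥-elim (x≢y x≡y)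
... | inj₂ (there x∈q) = ∈-++⁺ʳ p x∈q

-- Rebracketing used to place a rewrite u' m z' inside a context u _ z.
context-assoc : ∀ {A : Set} (u u' m z' z : List A) →
                (u ++ u') ++ m ++ z' ++ z ≡ u ++ (u' ++ m ++ z') ++ z
context-assoc u u' m z' z = trans (++-assoc u u' (m ++ z' ++ z))
  (cong (u ++_) (trans (cong (u' ++_) (sym (++-assoc m z' z))) (sym (++-assoc u' (m ++ z') z))))

Enumerates : ∀ {n} → List (Fin n) → Subset n → Set
Enumerates l A = Unique l × (∀ {x} → x ∈ l → x ∈ₛ A) × (∀ {x} → x ∈ₛ A → x ∈ l)

enumerates-∪ : ∀ {n} {l m : List (Fin n)} {A B} → Enumerates l A → Enumerates m B →
               (∀ {x} → x ∈ₛ A → ¬ x ∈ₛ B) → Enumerates (l ++ m) (A ∪ B)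
enumerates-∪ {l = l} {m} {A} {B} (ul , l⊆A , A⊆l) (um , m⊆B , B⊆m) disjoint =
  Unique.++⁺ ul um (λ (x∈l , x∈m) → disjoint (l⊆A x∈l) (m⊆B x∈m)) , lm⊆AB , AB⊆lm
  where
  lm⊆AB : ∀ {x} → x ∈ l ++ m → x ∈ₛ A ∪ B
  lm⊆AB x∈ with ∈-++⁻ l x∈
  ... | inj₁ x∈l = x∈p∪q⁺ (inj₁ (l⊆A x∈l))
  ... | inj₂ x∈m = x∈p∪q⁺ (inj₂ (m⊆B x∈m))
  AB⊆lm : ∀ {x} → x ∈ₛ A ∪ B → x ∈ l ++ m
  AB⊆lm x∈ with x∈p∪q⁻ A B x∈
  ... | inj₁ x∈A = ∈-++⁺ˡ (A⊆l x∈A)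
  ... | inj₂ x∈B = ∈-++⁺ʳ l (B⊆m x∈B)

setOf : ∀ {n} → Fin n → List (Fin n) → Subset n
setOf x [] = ⁅ x ⁆
setOf x (y ∷ l) = ⁅ x ⁆ ∪ setOf y l

setOf-⊆ : ∀ {n} {z : Fin n} x l → z ∈ₛ setOf x l → z ∈ x ∷ l
setOf-⊆ x [] z∈ = here (x∈⁅y⁆⇒x≡y x z∈)
setOf-⊆ x (y ∷ l) z∈ with x∈p∪q⁻ ⁅ x ⁆ (setOf y l) z∈
... | inj₁ z∈x = here (x∈⁅y⁆⇒x≡y x z∈x)
... | inj₂ z∈yl = there (setOf-⊆ y l z∈yl)

setOf-⊇ : ∀ {n} {z : Fin n} x l → z ∈ x ∷ l → z ∈ₛ setOf x l
setOf-⊇ x [] (here refl) = x∈⁅x⁆ x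
setOf-⊇ x (y ∷ l) (here refl) = x∈p∪q⁺ (inj₁ (x∈⁅x⁆ x))
setOf-⊇ x (y ∷ l) (there z∈) = x∈p∪q⁺ (inj₂ (setOf-⊇ y l z∈))

singletons : ∀ {n} → List (Fin n) → List (Subset n)
singletons = map ⁅_⁆

module Traces {n : ℕ} (ind : Rel (Fin n) 0ℓ) where

  Independent : List (Fin n) → Set
  Independent l = ∀ {x y} → x ∈ l → y ∈ l → x ≢ y → ind x y

  enumeration-independent : ∀ {l A} → IsStep ind A → Enumerates l A → Independent l
  enumeration-independent (_ , pairwise) (_ , l⊆A , _) x∈ y∈ = pairwise _ _ (l⊆A x∈) (l⊆A y∈)

  ∼-context : ∀ u z {l l'} → TraceEq ind l l' → TraceEq ind (u ++ l ++ z) (u ++ l' ++ z)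
  ∼-context u z = gmap (λ l → u ++ l ++ z) swap-context
    where
    swap-context : ∀ {l l'} → SeqStep ind l l' → SeqStep ind (u ++ l ++ z) (u ++ l' ++ z)
    swap-context (swap u' z' a b iab) =
      subst₂ (SeqStep ind) (context-assoc u u' (a ∷ b ∷ []) z' z) (context-assoc u u' (b ∷ a ∷ []) z' z)
        (swap (u ++ u') (z' ++ z) a b iab)

  ∼-cons : ∀ x {l l'} → TraceEq ind l l' → TraceEq ind (x ∷ l) (x ∷ l')
  ∼-cons x = gmap (x ∷_) (λ { (swap u z a b iab) → swap (x ∷ u) z a b iab })

  ∼-bubble : ∀ y p q → All (λ x → ind x y) p → TraceEq ind (p ++ y ∷ q) (y ∷ p ++ q)
  ∼-bubble y [] q [] = ε
  ∼-bubble y (x ∷ p) q (ixy ∷ ip) =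
    ∼-cons x (∼-bubble y p q ip) ◅◅ fwd (swap [] (p ++ q) x y ixy) ◅ ε

  -- Two duplicate-free lists with the same pairwise independent letters are
  -- trace equivalent: bring the first letter of m to the front and recurse.
  ∼-permute : ∀ l m → Unique l → Unique m → (∀ {x} → x ∈ l → x ∈ m) →
              (∀ {x} → x ∈ m → x ∈ l) → Independent l → TraceEq ind l m
  ∼-permute [] [] _ _ _ _ _ = ε
  ∼-permute (x ∷ l) [] _ _ l⊆m _ _ with l⊆m (here refl)
  ... | ()
  ∼-permute l (y ∷ m) ul (y∉m ∷ um) l⊆m m⊆l indep with ∈-∃++ (m⊆l (here refl))
  ... | p , q , refl = ∼-bubble y p q commute ◅◅ ∼-cons y (∼-permute (p ++ q) m upq um pq⊆m m⊆pq indep')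
    where
    y∉pq : All (y ≢_) (p ++ q)
    y∉pq = proj₁ (unique-remove p q ul)
    upq : Unique (p ++ q)
    upq = proj₂ (unique-remove p q ul)
    y∈l : y ∈ p ++ y ∷ q
    y∈l = ∈-++⁺ʳ p (here refl)
    commute : All (λ x → ind x y) p
    commute = tabulate λ x∈p →
      indep (∈-++⁺ˡ x∈p) y∈l (λ x≡y → lookup y∉pq (∈-++⁺ˡ x∈p) (sym x≡y))
    pq⊆m : ∀ {x} → x ∈ p ++ q → x ∈ m
    pq⊆m x∈ with l⊆m (∈-insert p q x∈)
    ... | here x≡y = ⊥-elim (lookup y∉pq x∈ (sym x≡y))
    ... | there x∈m = x∈m
    m⊆pq : ∀ {x} → x ∈ m → x ∈ p ++ q
    m⊆pq x∈m = ∈-remove p q (m⊆l (there x∈m)) (λ x≡y → lookup y∉m x∈m (sym x≡y))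
    indep' : Independent (p ++ q)
    indep' x∈ y∈ = indep (∈-insert p q x∈) (∈-insert p q y∈)

  enumerations-∼ : ∀ {A l m} → IsStep ind A → Enumerates l A → Enumerates m A → TraceEq ind l m
  enumerations-∼ sA el@(ul , l⊆A , A⊆l) (um , m⊆A , A⊆m) =
    ∼-permute _ _ ul um (λ x∈ → A⊆m (l⊆A x∈)) (λ x∈ → A⊆l (m⊆A x∈)) (enumeration-independent sA el)

  ≈-context : ∀ u z {t t'} → StepTraceEq ind t t' → StepTraceEq ind (u ++ t ++ z) (u ++ t' ++ z)
  ≈-context u z = gmap (λ t → u ++ t ++ z) merge-context
    where
    merge-context : ∀ {t t'} → StepStep ind t t' → StepStep ind (u ++ t ++ z) (u ++ t' ++ z)
    merge-context (merge u' z' A B sA sB iAB) =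
      subst₂ (StepStep ind) (context-assoc u u' (A ∷ B ∷ []) z' z) (context-assoc u u' [ A ∪ B ] z' z)
        (merge (u ++ u') (z' ++ z) A B sA sB iAB)

  ≈-cons : ∀ X {t t'} → StepTraceEq ind t t' → StepTraceEq ind (X ∷ t) (X ∷ t')
  ≈-cons X = gmap (X ∷_) (λ { (merge u z A B sA sB iAB) → merge (X ∷ u) z A B sA sB iAB })

  ⁅⁆-step : ∀ a → IsStep ind ⁅ a ⁆
  ⁅⁆-step a = (a , x∈⁅x⁆ a) , λ x y x∈ y∈ x≢y → ⊥-elim (x≢y (trans (x∈⁅y⁆⇒x≡y a x∈) (sym (x∈⁅y⁆⇒x≡y a y∈))))

  ⁅⁆-indep : ∀ {a b} → ind a b → Indep ind ⁅ a ⁆ ⁅ b ⁆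
  ⁅⁆-indep {a} {b} iab x y x∈ y∈ = subst₂ ind (sym (x∈⁅y⁆⇒x≡y a x∈)) (sym (x∈⁅y⁆⇒x≡y b y∈)) iab

  singletons-steps : ∀ w → IsStepSeq ind (singletons w)
  singletons-steps [] = []
  singletons-steps (a ∷ w) = ⁅⁆-step a ∷ singletons-steps w

  setOf-split : ∀ x l → Unique (x ∷ l) → Independent (x ∷ l) →
                StepTraceEq ind [ setOf x l ] (singletons (x ∷ l))
  setOf-split x [] _ _ = ε
  setOf-split x (y ∷ l) (x∉ ∷ u) indep =
    bwd (merge [] [] ⁅ x ⁆ (setOf y l) (⁅⁆-step x) rest-step x-indep)
      ◅ ≈-cons ⁅ x ⁆ (setOf-split y l u (λ a∈ b∈ → indep (there a∈) (there b∈)))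
    where
    rest-step : IsStep ind (setOf y l)
    rest-step = (y , setOf-⊇ y l (here refl)) ,
                λ a b a∈ b∈ → indep (there (setOf-⊆ y l a∈)) (there (setOf-⊆ y l b∈))
    x-indep : Indep ind ⁅ x ⁆ (setOf y l)
    x-indep a b a∈ b∈ with x∈⁅y⁆⇒x≡y x a∈
    ... | refl = indep (here refl) (there (setOf-⊆ y l b∈)) (λ a≡b → lookup x∉ (setOf-⊆ y l b∈) a≡b)

  step-split : ∀ {A} l → IsStep ind A → Enumerates l A → StepTraceEq ind [ A ] (singletons l)
  step-split [] ((a , a∈A) , _) (_ , _ , A⊆l) with A⊆l a∈A
  ... | ()
  step-split {A} (x ∷ l) sA el@(u , l⊆A , A⊆l) =
    subst (λ C → StepTraceEq ind [ C ] (singletons (x ∷ l))) setOf≡A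
      (setOf-split x l u (enumeration-independent sA el))
    where
    setOf≡A : setOf x l ≡ A
    setOf≡A = ⊆-antisym (λ z∈ → l⊆A (setOf-⊆ x l z∈)) (λ z∈ → setOf-⊇ x l (A⊆l z∈))

  ∪-step : Symmetric ind → ∀ {A B} → IsStep ind A → IsStep ind B → Indep ind A B → IsStep ind (A ∪ B)
  ∪-step sym-ind {A} {B} ((a , a∈A) , pwA) (_ , pwB) iAB = (a , x∈p∪q⁺ (inj₁ a∈A)) , pairwise
    where
    pairwise : ∀ x y → x ∈ₛ A ∪ B → y ∈ₛ A ∪ B → x ≢ y → ind x y
    pairwise x y x∈ y∈ x≢y with x∈p∪q⁻ A B x∈ | x∈p∪q⁻ A B y∈
    ... | inj₁ x∈A | inj₁ y∈A = pwA x y x∈A y∈A x≢y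
    ... | inj₁ x∈A | inj₂ y∈B = iAB x y x∈A y∈B
    ... | inj₂ x∈B | inj₁ y∈A = sym-ind (iAB y x y∈A x∈B)
    ... | inj₂ x∈B | inj₂ y∈B = pwB x y x∈B y∈B x≢y

module Lex {n : ℕ} (_≼_ : Rel (Fin n) 0ℓ) (isDTO : IsDecTotalOrder _≡_ _≼_) where

  private
    order : DecTotalOrder 0ℓ 0ℓ 0ℓ
    order = record { Carrier = Fin n ; _≈_ = _≡_ ; _≤_ = _≼_ ; isDecTotalOrder = isDTO }
  open Data.List.Sort order using (sort-↭)

  lex : List (Subset n) → List (Fin n)
  lex = lexSeq _≼_ isDTO

  lex-enumerates : ∀ A → Enumerates (lexStep _≼_ isDTO A) A
  lex-enumerates A =
      unique-↭ (↭-sym (sort-↭ _)) (Unique.filter⁺ (_∈? A) (Unique.allFin⁺ n))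
    , (λ x∈ → proj₂ (∈-filter⁻ (_∈? A) {xs = allFin n} (∈-resp-↭ (sort-↭ _) x∈)))
    , (λ x∈A → ∈-resp-↭ (↭-sym (sort-↭ _)) (∈-filter⁺ (_∈? A) (∈-allFin _) x∈A))

  lex-⁅⁆ : ∀ a → lexStep _≼_ isDTO ⁅ a ⁆ ≡ [ a ]
  lex-⁅⁆ a with lex-enumerates ⁅ a ⁆
  ... | u , ⊆⁅a⁆ , ⁅a⁆⊆ = unique-singleton _ u (λ x∈ → x∈⁅y⁆⇒x≡y a (⊆⁅a⁆ x∈)) (⁅a⁆⊆ (x∈⁅x⁆ a))

  lex-singletons : ∀ w → lex (singletons w) ≡ w
  lex-singletons [] = refl
  lex-singletons (a ∷ w) = cong₂ _++_ (lex-⁅⁆ a) (lex-singletons w)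

module Correspondence {n : ℕ} (ind : Rel (Fin n) 0ℓ) (irr : Irreflexive _≡_ ind) (sym-ind : Symmetric ind)
                      (_≼_ : Rel (Fin n) 0ℓ) (isDTO : IsDecTotalOrder _≡_ _≼_) where

  open Traces ind
  open Lex _≼_ isDTO

  private
    lexS : Subset n → List (Fin n)
    lexS = lexStep _≼_ isDTO

  -- A merge only permutes the letters of the merged step A ∪ B.
  merge-sound : ∀ {t t'} → StepStep ind t t' → TraceEq ind (lex t) (lex t')
  merge-sound (merge u z A B sA sB iAB) =
    subst₂ (TraceEq ind) (sym lex-before) (sym lex-after) (∼-context (lex u) (lex z) permute-A∪B)
    where
    open ≡-Reasoning
    lex-before : lex (u ++ A ∷ B ∷ z) ≡ lex u ++ (lexS A ++ lexS B) ++ lex z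
    lex-before = begin
      lex (u ++ A ∷ B ∷ z)              ≡⟨ concatMap-++ lexS u (A ∷ B ∷ z) ⟩
      lex u ++ lexS A ++ lexS B ++ lex z ≡⟨ cong (lex u ++_) (sym (++-assoc (lexS A) (lexS B) (lex z))) ⟩
      lex u ++ (lexS A ++ lexS B) ++ lex z ∎
    lex-after : lex (u ++ (A ∪ B) ∷ z) ≡ lex u ++ lexS (A ∪ B) ++ lex z
    lex-after = concatMap-++ lexS u ((A ∪ B) ∷ z)
    permute-A∪B : TraceEq ind (lexS A ++ lexS B) (lexS (A ∪ B))
    permute-A∪B = enumerations-∼ (∪-step sym-ind sA sB iAB)
      (enumerates-∪ (lex-enumerates A) (lex-enumerates B) (λ x∈A x∈B → irr refl (iAB _ _ x∈A x∈B)))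
      (lex-enumerates (A ∪ B))

  lex-sound : ∀ {t t'} → StepTraceEq ind t t' → TraceEq ind (lex t) (lex t')
  lex-sound = gfold (isEquivalence (SeqStep ind)) lex merge-sound

  -- A swap of independent letters is a merge into ⁅a⁆ ∪ ⁅b⁆ = ⁅b⁆ ∪ ⁅a⁆
  -- followed by the inverse merge.
  swap-complete : ∀ {w w'} → SeqStep ind w w' → StepTraceEq ind (singletons w) (singletons w')
  swap-complete (swap u z a b iab) =
    subst₂ (StepTraceEq ind) (sym (map-++ ⁅_⁆ u (a ∷ b ∷ z))) (sym (map-++ ⁅_⁆ u (b ∷ a ∷ z)))
      (fwd (merge su sz ⁅ a ⁆ ⁅ b ⁆ (⁅⁆-step a) (⁅⁆-step b) (⁅⁆-indep iab))
        ◅ split-ba ◅ ε)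
    where
    su sz : List (Subset n)
    su = singletons u
    sz = singletons z
    split-ba : SymClosure (StepStep ind) (su ++ (⁅ a ⁆ ∪ ⁅ b ⁆) ∷ sz) (su ++ ⁅ b ⁆ ∷ ⁅ a ⁆ ∷ sz)
    split-ba = subst (λ C → SymClosure (StepStep ind) (su ++ C ∷ sz) (su ++ ⁅ b ⁆ ∷ ⁅ a ⁆ ∷ sz))
                 (∪-comm ⁅ b ⁆ ⁅ a ⁆)
                 (bwd (merge su sz ⁅ b ⁆ ⁅ a ⁆ (⁅⁆-step b) (⁅⁆-step a) (⁅⁆-indep (sym-ind iab))))

  singletons-complete : ∀ {w w'} → TraceEq ind w w' → StepTraceEq ind (singletons w) (singletons w')
  singletons-complete = gfold (isEquivalence (StepStep ind)) singletons swap-complete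

  normal-form : ∀ t → IsStepSeq ind t → StepTraceEq ind t (singletons (lex t))
  normal-form [] [] = ε
  normal-form (A ∷ t) (sA ∷ st) =
    subst (StepTraceEq ind (A ∷ t)) (sym (map-++ ⁅_⁆ (lexS A) (lex t)))
      (≈-cons A (normal-form t st) ◅◅ ≈-context [] (singletons (lex t)) (step-split (lexS A) sA (lex-enumerates A)))

theorem2p12 : (n : ℕ) → 0 < n →
    (ind : Rel (Fin n) 0ℓ) → Irreflexive _≡_ ind → Symmetric ind →
    (_≼_ : Rel (Fin n) 0ℓ) → (isDTO : IsDecTotalOrder _≡_ _≼_) →
    (w : List (Fin n)) →
    ∃ λ (t : List (Subset n)) →
      IsStepSeq ind t × LexOfClassIs ind _≼_ isDTO t w
      × (∀ (t' : List (Subset n)) → IsStepSeq ind t' →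
           LexOfClassIs ind _≼_ isDTO t' w → StepTraceEq ind t t')
theorem2p12 n _ ind irr sym-ind _≼_ isDTO w = singletons w , singletons-steps w , lex-class , unique
  where
  open Traces ind using (singletons-steps)
  open Lex _≼_ isDTO using (lex; lex-singletons)
  open Correspondence ind irr sym-ind _≼_ isDTO

  lex-class : LexOfClassIs ind _≼_ isDTO (singletons w) w
  lex-class v = (λ w∼v → singletons v , singletons-complete w∼v , lex-singletons v)
              , λ { (t' , eq , refl) → subst (λ x → TraceEq ind x (lex t')) (lex-singletons w) (lex-sound eq) }

  unique : ∀ t' → IsStepSeq ind t' → LexOfClassIs ind _≼_ isDTO t' w → StepTraceEq ind (singletons w) t'
  unique t' st' lex-class' =
    singletons-complete w∼lex-t' ◅◅ symmetric (StepStep ind) (normal-form t' st')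
    where
    w∼lex-t' : TraceEq ind w (lex t')
    w∼lex-t' = proj₂ (lex-class' (lex t')) (t' , ε , refl)
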